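{- Let $B$ be a set of bids and $A$ a set of asks, and let $M$ be a matching over $(B,A)$. Then for every number $p$, $$\mathsf{Vol}(M)\le \mathsf{Vol}(B_{>p})+\mathsf{Vol}(A_{<p})+\min\big(\mathsf{Vol}(B_{=p}),\mathsf{Vol}(A_{=p})\big),$$ where $B_{>p}\subseteq B$ is the set of bids with limit price greater than $p$, $A_{<p}\subseteq A$ is the set of asks with limit price less than $p$, and $B_{=p}\subseteq B$ (resp. $A_{=p}\subseteq A$) is the set of bids (resp. asks) with limit price exactly $p$.
   Context: An order $w$ (a bid or an ask) has a limit price $\mathsf{price}(w)$ and a quantity $\mathsf{qty}(w)\ge 1$ (natural numbers), as well as a distinct id. A bid $b$ and an ask $a$ are tradable if $\mathsf{price}(b)\ge\mathsf{price}(a)$. A transaction between a bid and an ask consists of a transaction price and a transaction quantity. For a set of transactions $M$ and an order $w$, $\mathsf{Qty}(w,M)$ is the sum of transaction quantities of transactions in $M$ involving $w$, and $\mathsf{Vol}(M)$ is the sum of all transaction quantities in $M$. For a set $\Omega$ of orders, $\mathsf{Vol}(\Omega)$ is the sum of the quantities of the orders in $\Omega$. A set of transactions $M$ is a matching over $(B,A)$ if every transaction in $M$ is between a bid of $B$ and an ask of $A$ that are tradable, and $\mathsf{Qty}(w,M)\le\mathsf{qty}(w)$ for every $w\in B\cup A$. -}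

module Defs where

open import Data.Nat as ℕ using (ℕ; _+_)
open import Data.Rational as ℚ using (ℚ)
open import Data.List using (List; map; filter)
open import Data.Nat.ListAction using (sum)
open import Data.Sum using (_⊎_)
open import Data.List.Membership.Propositional using (_∈_)
open import Data.List.Relation.Unary.Unique.Propositional using (Unique)
open import Data.List.Relation.Unary.All using (All)
open import Data.Product using (_×_)
open import Relation.Nullary.Decidable using (_⊎-dec_)
open import Relation.Unary using (Decidable)
open import Relation.Binary.PropositionalEquality using (_≡_)

Price : Set
Price = ℚ

record Order : Set where
  constructor order
  field
    id    : ℕ
    price : Price
    qty   : ℕ
    qty≥1 : 1 ℕ.≤ qty
open Order public

record Transaction : Set where
  constructor transaction
  field
    bid    : Order
    ask    : Order
    tprice : Price
    tqty   : ℕ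
open Transaction public

Tradable : Order → Order → Set
Tradable b a = price a ℚ.≤ price b

VolO : List Order → ℕ
VolO Ω = sum (map qty Ω)

Vol : List Transaction → ℕ
Vol M = sum (map tqty M)

-- Qty(w, M): sum of transaction quantities of transactions in M involving w.
-- Orders are identified by their (distinct) ids.
involves : Order → Transaction → Set
involves w t = (id (bid t) ≡ id w) ⊎ (id (ask t) ≡ id w)

involves? : (w : Order) → Decidable (involves w)
involves? w t = (id (bid t) ℕ.≟ id w) ⊎-dec (id (ask t) ℕ.≟ id w)

Qty : Order → List Transaction → ℕ
Qty w M = Vol (filter (involves? w) M)

-- Sets of orders: lists with pairwise distinct ids.
DistinctIds : List Order → Set
DistinctIds Ω = Unique (map id Ω)

IsMatching : List Order → List Order → List Transaction → Set
IsMatching B A M =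
  All (λ t → bid t ∈ B × ask t ∈ A × Tradable (bid t) (ask t)) M
  × All (λ w → Qty w M ℕ.≤ qty w) B
  × All (λ w → Qty w M ℕ.≤ qty w) A

_>ₚ_ : List Order → Price → List Order
Ω >ₚ p = filter (λ w → p ℚ.<? price w) Ω

_<ₚ_ : List Order → Price → List Order
Ω <ₚ p = filter (λ w → price w ℚ.<? p) Ω

_=ₚ_ : List Order → Price → List Order
Ω =ₚ p = filter (λ w → price w ℚ.≟ p) Ω

{-# OPTIONS --safe #-}
-- Split the transactions of M into those whose bid is priced above p, those
-- whose bid is not but whose ask is priced below p, and the rest, for which
-- tradability squeezes both prices to exactly p. The three groups are covered
-- by B_{>p}, by A_{<p}, and by both B_{=p} and A_{=p}, respectively; and
-- transactions covered by a set Ω of orders have volume at most Vol(Ω), since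
-- every order w takes part in at most qty(w) of that volume.
module Submission where

open import Defs
open import Algebra.Properties.CommutativeSemigroup using (x∙yz≈y∙xz)
open import Data.List using (List; []; _∷_; _++_; map; filter)
open import Data.List.Membership.Propositional using (_∈_)
open import Data.List.Membership.Propositional.Properties using (∈-filter⁺)
open import Data.List.Relation.Binary.Sublist.Propositional
  using (_⊆_; []; _∷_; _∷ʳ_; ⊆-trans)
open import Data.List.Relation.Binary.Sublist.Propositional.Properties
  using (filter-⊆; map⁺) renaming (filter⁺ to filter⁺-⊆)
open import Data.List.Relation.Unary.All as All using (All; []; _∷_)
open import Data.List.Relation.Unary.All.Properties using (all-filter; filter⁺)
open import Data.List.Relation.Unary.Any as Any using (Any)
open import Data.List.Relation.Unary.Unique.Propositional using (Unique)
open import Data.Nat using (ℕ; _≤_; _+_; _⊓_; z≤n)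
open import Data.Nat.ListAction using (sum)
open import Data.Nat.Properties
  using (≤-trans; m≤n+m; +-mono-≤; +-monoʳ-≤; +-assoc; ⊓-glb; +-commutativeSemigroup
        ; module ≤-Reasoning)
import Data.Rational as ℚ
import Data.Rational.Properties as ℚ
open import Data.Product using (_×_; _,_; proj₁; proj₂)
open import Data.Sum using (inj₁; inj₂)
open import Level using (Level)
open import Relation.Nullary using (¬_; yes; no)
open import Relation.Unary using (Pred; Decidable)
open import Relation.Unary.Properties using (∁?)
open import Relation.Binary.PropositionalEquality using (_≡_; refl; sym; trans; cong)

private
  variable
    a : Level
    A : Set a

sum-mono-⊆ : {ms ns : List ℕ} → ms ⊆ ns → sum ms ≤ sum ns
sum-mono-⊆ []             = z≤n
sum-mono-⊆ (n ∷ʳ ms⊆ns)   = ≤-trans (sum-mono-⊆ ms⊆ns) (m≤n+m _ n)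
sum-mono-⊆ (refl ∷ ms⊆ns) = +-monoʳ-≤ _ (sum-mono-⊆ ms⊆ns)

sum-map-filter-∁ : (f : A → ℕ) {P : Pred A a} (P? : Decidable P) (xs : List A) →
  sum (map f xs) ≡ sum (map f (filter P? xs)) + sum (map f (filter (∁? P?) xs))
sum-map-filter-∁ f P? []       = refl
sum-map-filter-∁ f P? (x ∷ xs) with P? x
... | yes _ = trans (cong (f x +_) (sum-map-filter-∁ f P? xs)) (sym (+-assoc (f x) _ _))
... | no _  = trans (cong (f x +_) (sum-map-filter-∁ f P? xs))
                    (x∙yz≈y∙xz +-commutativeSemigroup (f x) (sum (map f (filter P? xs))) _)

filter-All-∩ : {P Q : Pred A a} (P? : Decidable P) {xs : List A} →
  All Q xs → All (λ x → Q x × P x) (filter P? xs)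
filter-All-∩ P? {xs} Qxs = All.zip (filter⁺ P? Qxs , all-filter P? xs)

squeeze : {x y p : ℚ.ℚ} → x ℚ.≤ y → ¬ p ℚ.< y → ¬ x ℚ.< p → y ≡ p × x ≡ p
squeeze x≤y p≮y x≮p =
    ℚ.≤-antisym (ℚ.≮⇒≥ p≮y) (ℚ.≤-trans (ℚ.≮⇒≥ x≮p) x≤y)
  , ℚ.≤-antisym (ℚ.≤-trans x≤y (ℚ.≮⇒≥ p≮y)) (ℚ.≮⇒≥ x≮p)

Vol-filter-∁ : {P : Pred Transaction a} (P? : Decidable P) (N : List Transaction) →
  Vol N ≡ Vol (filter P? N) + Vol (filter (∁? P?) N)
Vol-filter-∁ = sum-map-filter-∁ tqty

Qty-mono-⊆ : ∀ w {N M : List Transaction} → N ⊆ M → Qty w N ≤ Qty w M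
Qty-mono-⊆ w N⊆M =
  sum-mono-⊆ (map⁺ tqty (filter⁺-⊆ (involves? w) (involves? w) (λ { refl inv → inv }) N⊆M))

involves-bid : ∀ t → involves (bid t) t
involves-bid _ = inj₁ refl

involves-ask : ∀ t → involves (ask t) t
involves-ask _ = inj₂ refl

Covered : List Order → Transaction → Set
Covered Ω t = Any (λ w → involves w t) Ω

covered⇒Vol≤VolO : ∀ Ω N → All (Covered Ω) N → All (λ w → Qty w N ≤ qty w) Ω → Vol N ≤ VolO Ω
covered⇒Vol≤VolO []      []      []       []                   = z≤n
covered⇒Vol≤VolO []      (_ ∷ _) (() ∷ _) []
covered⇒Vol≤VolO (w ∷ Ω) N       covered  (Qty≤qty ∷ Qty≤qtys) = begin
  Vol N             ≡⟨ Vol-filter-∁ (involves? w) N ⟩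
  Qty w N + Vol N′  ≤⟨ +-mono-≤ Qty≤qty (covered⇒Vol≤VolO Ω N′ covered′ Qty≤qtys′) ⟩
  qty w + VolO Ω    ∎
  where
  open ≤-Reasoning
  N′ : List Transaction
  N′ = filter (∁? (involves? w)) N
  covered′ : All (Covered Ω) N′
  covered′ = All.zipWith (λ (¬inv , cov) → Any.tail ¬inv cov)
    (all-filter (∁? (involves? w)) N , filter⁺ (∁? (involves? w)) covered)
  Qty≤qtys′ : All (λ v → Qty v N′ ≤ qty v) Ω
  Qty≤qtys′ = All.map (λ {v} → ≤-trans (Qty-mono-⊆ v (filter-⊆ (∁? (involves? w)) N))) Qty≤qtys

Vol≤VolO-filter : (side : Transaction → Order) → (∀ t → involves (side t) t) →
  {P : Pred Order a} (P? : Decidable P) {Ω : List Order} {N M : List Transaction} →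
  N ⊆ M → All (λ w → Qty w M ≤ qty w) Ω → All (λ t → side t ∈ Ω × P (side t)) N →
  Vol N ≤ VolO (filter P? Ω)
Vol≤VolO-filter side involves-side P? {Ω} {N} N⊆M Qty≤qtys sides =
  covered⇒Vol≤VolO (filter P? Ω) N
    (All.map (λ {t} (∈Ω , P-side) → Any.map (λ { refl → involves-side t }) (∈-filter⁺ P? ∈Ω P-side))
             sides)
    (filter⁺ P? (All.map (λ {w} → ≤-trans (Qty-mono-⊆ w N⊆M)) Qty≤qtys))

Matched : List Order → List Order → Transaction → Set
Matched B A t = bid t ∈ B × ask t ∈ A × Tradable (bid t) (ask t)

bidAbove? : (p : Price) → Decidable (λ t → p ℚ.< price (bid t))
bidAbove? p t = p ℚ.<? price (bid t)

askBelow? : (p : Price) → Decidable (λ t → price (ask t) ℚ.< p)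
askBelow? p t = price (ask t) ℚ.<? p

module _ (p : Price) {B A : List Order} {M : List Transaction} (matching : IsMatching B A M) where

  private
    matched : All (Matched B A) M
    matched = proj₁ matching
    Qty≤qtyᴮ : All (λ w → Qty w M ≤ qty w) B
    Qty≤qtyᴮ = proj₁ (proj₂ matching)
    Qty≤qtyᴬ : All (λ w → Qty w M ≤ qty w) A
    Qty≤qtyᴬ = proj₂ (proj₂ matching)
    R : List Transaction
    R = filter (∁? (bidAbove? p)) M
    R⊆M : R ⊆ M
    R⊆M = filter-⊆ (∁? (bidAbove? p)) M

  Vol-bidAbove≤VolO : Vol (filter (bidAbove? p) M) ≤ VolO (B >ₚ p)
  Vol-bidAbove≤VolO = Vol≤VolO-filter bid involves-bid _ (filter-⊆ (bidAbove? p) M) Qty≤qtyᴮ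
    (All.map (λ ((b∈B , _) , above) → b∈B , above) (filter-All-∩ (bidAbove? p) matched))

  Vol-askBelow≤VolO : Vol (filter (askBelow? p) (filter (∁? (bidAbove? p)) M)) ≤ VolO (A <ₚ p)
  Vol-askBelow≤VolO =
    Vol≤VolO-filter ask involves-ask _ (⊆-trans (filter-⊆ (askBelow? p) R) R⊆M) Qty≤qtyᴬ
      (All.map (λ (((_ , a∈A , _) , _) , below) → a∈A , below)
               (filter-All-∩ (askBelow? p) (filter-All-∩ (∁? (bidAbove? p)) matched)))

  Vol-atPrice≤VolO : Vol (filter (∁? (askBelow? p)) (filter (∁? (bidAbove? p)) M))
                     ≤ VolO (B =ₚ p) ⊓ VolO (A =ₚ p)
  Vol-atPrice≤VolO = ⊓-glb
    (Vol≤VolO-filter bid involves-bid _ M₃⊆M Qty≤qtyᴮ (All.map proj₁ at-p))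
    (Vol≤VolO-filter ask involves-ask _ M₃⊆M Qty≤qtyᴬ (All.map proj₂ at-p))
    where
    M₃ : List Transaction
    M₃ = filter (∁? (askBelow? p)) R
    M₃⊆M : M₃ ⊆ M
    M₃⊆M = ⊆-trans (filter-⊆ (∁? (askBelow? p)) R) R⊆M
    at : ∀ {t} → (Matched B A t × ¬ p ℚ.< price (bid t)) × ¬ price (ask t) ℚ.< p →
         (bid t ∈ B × price (bid t) ≡ p) × (ask t ∈ A × price (ask t) ≡ p)
    at (((b∈B , a∈A , tradable) , ¬above) , ¬below) =
      let bid≡p , ask≡p = squeeze tradable ¬above ¬below in (b∈B , bid≡p) , (a∈A , ask≡p)
    at-p : All (λ t → (bid t ∈ B × price (bid t) ≡ p) × (ask t ∈ A × price (ask t) ≡ p)) M₃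
    at-p = All.map (λ {t} → at {t})
      (filter-All-∩ (∁? (askBelow? p)) (filter-All-∩ (∁? (bidAbove? p)) matched))

mainTheorem2 : (B A : List Order) (M : List Transaction) →
    Unique (map Order.id (B ++ A)) →
    IsMatching B A M →
    (p : Price) →
    Vol M ≤ VolO (B >ₚ p) + VolO (A <ₚ p) + (VolO (B =ₚ p) ⊓ VolO (A =ₚ p))
mainTheorem2 B A M _ matching p = begin
  Vol M                       ≡⟨ Vol-filter-∁ (bidAbove? p) M ⟩
  Vol M₁ + Vol R              ≡⟨ cong (Vol M₁ +_) (Vol-filter-∁ (askBelow? p) R) ⟩
  Vol M₁ + (Vol M₂ + Vol M₃)  ≤⟨ +-mono-≤ (Vol-bidAbove≤VolO p matching)
                                   (+-mono-≤ (Vol-askBelow≤VolO p matching)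
                                             (Vol-atPrice≤VolO p matching)) ⟩
  VolO (B >ₚ p) + (VolO (A <ₚ p) + (VolO (B =ₚ p) ⊓ VolO (A =ₚ p)))
                              ≡⟨ +-assoc (VolO (B >ₚ p)) _ _ ⟨
  VolO (B >ₚ p) + VolO (A <ₚ p) + (VolO (B =ₚ p) ⊓ VolO (A =ₚ p)) ∎
  where
  open ≤-Reasoning
  R M₁ M₂ M₃ : List Transaction
  R  = filter (∁? (bidAbove? p)) M
  M₁ = filter (bidAbove? p) M
  M₂ = filter (askBelow? p) R
  M₃ = filter (∁? (askBelow? p)) R
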